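{- Fix an integer $t\geq 1$. Let $G$ be a graph and let $V_1,\dots,V_n$ be a partition of $V(G)$ such that, for each $i\in\{1,\dots,n\}$, $|V_i|\geq t$ and there are at most $\frac{t}{4}|V_i|$ edges of $G$ with exactly one endpoint in $V_i$. Then there exist at least $(\frac{t}{2})^n$ independent transversals of $V_1,\dots,V_n$.
   Context: Graphs are finite and simple. A transversal of a partition $V_1,\dots,V_n$ of $V(G)$ is a set $X$ with $|X\cap V_i|=1$ for each $i$; it is independent if no edge of $G$ has both endpoints in $X$. -}

module Defs where

open import Data.Nat using (ℕ; zero; suc; _+_; _<_)
open import Data.Bool using (Bool; true; false; _∧_; _xor_; if_then_else_)
open import Data.Fin using (Fin; zero; suc; _≟_; _<?_)
open import Data.Fin.Subset using (Subset; _∈_)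
open import Relation.Nullary using (¬_)
open import Relation.Nullary.Decidable using (⌊_⌋)
open import Relation.Binary.PropositionalEquality using (_≡_)

record Graph (m : ℕ) : Set where
  field
    adj     : Fin m → Fin m → Bool
    sym     : ∀ u v → adj u v ≡ adj v u
    irrefl  : ∀ v → adj v v ≡ false

open Graph public

countFin : (k : ℕ) → (Fin k → Bool) → ℕ
countFin zero    p = 0
countFin (suc k) p = (if p zero then 1 else 0) + countFin k (λ x → p (suc x))

sumFin : (k : ℕ) → (Fin k → ℕ) → ℕ
sumFin zero    f = 0
sumFin (suc k) f = f zero + sumFin k (λ x → f (suc x))

-- A partition V_1,...,V_n of V(G) = Fin m is given by the map part
-- sending each vertex to the index of its part; V_i = { v | part v ≡ i }.
inPart : ∀ {m n} → (Fin m → Fin n) → Fin n → Fin m → Bool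
inPart part i v = ⌊ part v ≟ i ⌋

partSize : ∀ {m n} → (Fin m → Fin n) → Fin n → ℕ
partSize {m} part i = countFin m (inPart part i)

boundaryEdges : ∀ {m n} → Graph m → (Fin m → Fin n) → Fin n → ℕ
boundaryEdges {m} G part i = sumFin m (λ u → countFin m (λ v →
    ⌊ u <? v ⌋ ∧ adj G u v ∧ (inPart part i u xor inPart part i v)))

IsTransversal : ∀ {m n} → (Fin m → Fin n) → Subset m → Set
IsTransversal {m} part X =
  ∀ i → countFin m (λ v → ⌊ v ∈? X ⌋ ∧ inPart part i v) ≡ 1
  where
  open import Data.Fin.Subset.Properties using (_∈?_)

IsIndependent : ∀ {m} → Graph m → Subset m → Set
IsIndependent G X = ∀ u v → u ∈ X → v ∈ X → ¬ (adj G u v ≡ true)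

module Submission where

-- For a set S of parts let c(S) be the number of independent transversals of the
-- parts in S.  The heart of the proof is t·c(S ∖ i) ≤ 2·c(S) for i ∈ S, by induction
-- on |S|.  Fix v ∈ V_i.  An independent transversal Y of S ∖ i either contains no
-- neighbour of v, and then Y + v is an independent transversal of S through v, or it
-- contains a neighbour u ∉ V_i of v; deleting u maps those Y injectively to
-- transversals of S ∖ i ∖ part(u), of which there are at most 2·c(S ∖ i)/t by
-- induction.  Hence t·c(S ∖ i) ≤ t·#(transversals of S through v) + 2·c(S ∖ i)·d(v),
-- where d(v) counts the neighbours of v outside V_i.  Summing over v ∈ V_i, each
-- transversal of S passes through exactly one v, and the d(v) add up to the number
-- e_i of edges leaving V_i, so |V_i|·t·c(S ∖ i) ≤ t·c(S) + 2·c(S ∖ i)·e_i; now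
-- 4·e_i ≤ t·|V_i| and t ≤ |V_i| give the claim.  Removing the parts one at a time,
-- starting from c(∅) = 1, yields t^n ≤ 2^n·c(all parts).

open import Defs hiding (sym)
open import Data.Bool using (Bool; true; false; not; if_then_else_; _∧_; _xor_)
open import Data.Bool.Properties using () renaming (_≟_ to _≟ᵇ_)
open import Data.Fin using (Fin; zero; suc; _≟_; _<?_)
open import Data.Fin.Properties using (0≢1+n; suc-injective; <-cmp; all?; any?; ¬∀⟶∃¬)
open import Data.Fin.Subset using (Subset; _∈_; _∉_; inside; outside; _-_; ⁅_⁆; ∣_∣; ⊥; ⊤; Empty)
open import Data.Fin.Subset.Properties
  using (_∈?_; nonempty?; Empty-unique; ∉⊥; ∈⊤; ∣⊥∣≡0; ∣⊤∣≡n; x∈p∧x≢y⇒x∈p-y; p─q⊆p; p─⊥≡p; x∈p⇒∣p-x∣<∣p∣)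
open import Data.List using (List; []; _∷_; _++_; map; length; filter)
open import Data.List.Properties using (length-++; filter-++)
open import Data.List.Membership.Propositional using () renaming (_∈_ to _∈ₗ_)
open import Data.List.Membership.Propositional.Properties using (∈-map⁻)
import Data.List.Relation.Unary.All as All
open All using (All)
open import Data.List.Relation.Unary.All.Properties using (all-filter)
open import Data.List.Relation.Unary.AllPairs using ([]; _∷_)
open import Data.List.Relation.Unary.Unique.Propositional using (Unique)
import Data.List.Relation.Unary.Unique.Propositional.Properties as Unique
open import Data.Nat using (ℕ; zero; suc; _+_; _*_; _^_; _≤_; z≤n; >-nonZero)
open import Data.Nat.Induction using (<-wellFounded)
open import Data.Nat.Properties
  using (≤-refl; ≤-trans; ≤-reflexive; ≤-antisym; ≮⇒≥; <⇒≱; m≤m+n; m≤n+m;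
         +-mono-≤; +-monoˡ-≤; +-monoʳ-≤; +-mono-<; +-cancelʳ-≤; *-monoʳ-≤; *-monoˡ-≤; *-cancelˡ-≤;
         +-comm; *-comm; *-assoc; *-identityˡ; *-zeroʳ; *-distribˡ-+;
         +-0-commutativeMonoid; +-*-semiring; +-commutativeSemigroup; *-commutativeSemigroup; module ≤-Reasoning)
open import Data.Nat.Tactic.RingSolver using (solve-∀)
open import Data.Product using (Σ; _×_; _,_; proj₁; proj₂; ∃; ∃-syntax)
open import Data.Sum using (_⊎_; inj₁; inj₂; [_,_]′)
open import Data.Vec using ([]; _∷_; here; there; lookup; updateAt)
open import Data.Vec.Properties using (∷-injectiveʳ; []=⇒lookup; lookup⇒[]=; lookup∘updateAt; lookup∘updateAt′)
open import Function using (_∘_)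
import Induction.WellFounded as WF
open import Relation.Binary using (tri<; tri≈; tri>)
import Relation.Binary.Construct.On as On
open import Relation.Binary.PropositionalEquality
  using (_≡_; _≢_; refl; sym; trans; cong; cong₂; subst; module ≡-Reasoning)
open import Relation.Nullary using (¬_; Dec; yes; no; does; contradiction; ¬?)
open import Relation.Nullary.Decidable
  using (⌊_⌋; map′; _×-dec_; _→-dec_; decidable-stable; isYes≗does; dec-true; dec-false)
open import Relation.Unary using (Pred; Decidable)

open import Algebra.Properties.CommutativeMonoid.Sum +-0-commutativeMonoid
  using (sum; sum-syntax; sum-cong-≗; ∑-distrib-+; ∑-comm)
open import Algebra.Properties.Semiring.Sum +-*-semiring using (*-distribˡ-sum; *-distribʳ-sum)
open import Algebra.Properties.CommutativeSemigroup +-commutativeSemigroup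
  using () renaming (interchange to +-interchange)
open import Algebra.Properties.CommutativeSemigroup *-commutativeSemigroup
  using () renaming (x∙yz≈y∙xz to *-left-comm)

-- Through ⌊_⌋ rather than does, so that the Boolean counts of Defs unfold to sums of 𝟙.
𝟙 : ∀ {a} {P : Set a} → Dec P → ℕ
𝟙 d = if ⌊ d ⌋ then 1 else 0

⌊⌋-yes : ∀ {a} {P : Set a} (d : Dec P) → P → ⌊ d ⌋ ≡ true
⌊⌋-yes d p = trans (isYes≗does d) (dec-true d p)

⌊⌋-no : ∀ {a} {P : Set a} (d : Dec P) → ¬ P → ⌊ d ⌋ ≡ false
⌊⌋-no d ¬p = trans (isYes≗does d) (dec-false d ¬p)

⌊⌋-× : ∀ {a b} {P : Set a} {Q : Set b} (d : Dec P) (e : Dec Q) → ⌊ d ×-dec e ⌋ ≡ ⌊ d ⌋ ∧ ⌊ e ⌋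
⌊⌋-× (yes _) (yes _) = refl
⌊⌋-× (yes _) (no _)  = refl
⌊⌋-× (no _)  _       = refl

𝟙-yes : ∀ {a} {P : Set a} (d : Dec P) → P → 𝟙 d ≡ 1
𝟙-yes (yes _) _ = refl
𝟙-yes (no ¬p) p = contradiction p ¬p

𝟙-no : ∀ {a} {P : Set a} (d : Dec P) → ¬ P → 𝟙 d ≡ 0
𝟙-no (yes p) ¬p = contradiction p ¬p
𝟙-no (no _)  _  = refl

𝟙-mono : ∀ {a b} {P : Set a} {Q : Set b} (d : Dec P) (e : Dec Q) → (P → Q) → 𝟙 d ≤ 𝟙 e
𝟙-mono (yes p) e f = ≤-reflexive (sym (𝟙-yes e (f p)))
𝟙-mono (no _)  e f = z≤n

𝟙-× : ∀ {a b} {P : Set a} {Q : Set b} (d : Dec P) (e : Dec Q) → 𝟙 (d ×-dec e) ≡ 𝟙 d * 𝟙 e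
𝟙-× (yes _) (yes _) = refl
𝟙-× (yes _) (no _)  = refl
𝟙-× (no _)  _       = refl

1≤if-∧-true : ∀ {a b c} → a ≡ true → b ≡ true → c ≡ true → 1 ≤ (if a ∧ b ∧ c then 1 else 0)
1≤if-∧-true refl refl refl = ≤-refl

sum-mono-≤ : ∀ {k} {f g : Fin k → ℕ} → (∀ x → f x ≤ g x) → sum f ≤ sum g
sum-mono-≤ {zero}  f≤g = z≤n
sum-mono-≤ {suc k} f≤g = +-mono-≤ (f≤g zero) (sum-mono-≤ (f≤g ∘ suc))

sum-zero : ∀ {k} {f : Fin k → ℕ} → (∀ x → f x ≡ 0) → sum f ≡ 0
sum-zero {zero}  f≡0 = refl
sum-zero {suc k} f≡0 = cong₂ _+_ (f≡0 zero) (sum-zero (f≡0 ∘ suc))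

≤-sum : ∀ {k} (f : Fin k → ℕ) x → f x ≤ sum f
≤-sum f zero    = m≤m+n (f zero) _
≤-sum f (suc x) = ≤-trans (≤-sum (f ∘ suc) x) (m≤n+m _ (f zero))

∑-𝟙≤1 : ∀ {k p} {P : Pred (Fin k) p} (P? : Decidable P) →
        (∀ {x y} → P x → P y → x ≡ y) → ∑[ x < k ] 𝟙 (P? x) ≤ 1
∑-𝟙≤1 {zero}  P? unique = z≤n
∑-𝟙≤1 {suc k} P? unique with P? zero
... | yes P0 = ≤-reflexive (cong suc (sum-zero (λ x → 𝟙-no (P? (suc x)) (0≢1+n ∘ unique P0))))
... | no _   = ∑-𝟙≤1 (P? ∘ suc) (λ Px Py → suc-injective (unique Px Py))

∑-𝟙≡1 : ∀ {k p} {P : Pred (Fin k) p} (P? : Decidable P) →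
        ∃ P → (∀ {x y} → P x → P y → x ≡ y) → ∑[ x < k ] 𝟙 (P? x) ≡ 1
∑-𝟙≡1 P? (x , Px) unique = ≤-antisym (∑-𝟙≤1 P? unique)
  (≤-trans (≤-reflexive (sym (𝟙-yes (P? x) Px))) (≤-sum (𝟙 ∘ P?) x))

sumFin≡sum : ∀ k (f : Fin k → ℕ) → sumFin k f ≡ sum f
sumFin≡sum zero    f = refl
sumFin≡sum (suc k) f = cong (f zero +_) (sumFin≡sum k (f ∘ suc))

countFin≡sum : ∀ k (p : Fin k → Bool) → countFin k p ≡ ∑[ x < k ] (if p x then 1 else 0)
countFin≡sum zero    p = refl
countFin≡sum (suc k) p = cong ((if p zero then 1 else 0) +_) (countFin≡sum k (p ∘ suc))

∑∑-≤-symmetrised : ∀ {k} (g h : Fin k → Fin k → ℕ) → (∀ x y → g x y + g y x ≤ h x y + h y x) →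
                   ∑[ x < k ] ∑[ y < k ] g x y ≤ ∑[ x < k ] ∑[ y < k ] h x y
∑∑-≤-symmetrised {k} g h g≤h = ≮⇒≥ (λ h<g → <⇒≱ (+-mono-< h<g h<g) (begin
  ∑∑ g + ∑∑ g                          ≡⟨ ∑∑-symmetrise g ⟩
  ∑∑ (λ x y → g x y + g y x)           ≤⟨ sum-mono-≤ (λ x → sum-mono-≤ (g≤h x)) ⟩
  ∑∑ (λ x y → h x y + h y x)           ≡⟨ ∑∑-symmetrise h ⟨
  ∑∑ h + ∑∑ h                          ∎))
  where
  open ≤-Reasoning
  ∑∑ : (Fin k → Fin k → ℕ) → ℕ
  ∑∑ f = ∑[ x < k ] ∑[ y < k ] f x y
  ∑∑-symmetrise : ∀ f → ∑∑ f + ∑∑ f ≡ ∑∑ (λ x y → f x y + f y x)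
  ∑∑-symmetrise f = begin-equality
    ∑∑ f + ∑∑ f                                       ≡⟨ cong (∑∑ f +_) (∑-comm f) ⟩
    ∑∑ f + ∑[ x < k ] ∑[ y < k ] f y x                ≡⟨ ∑-distrib-+ (λ x → ∑[ y < k ] f x y) _ ⟨
    ∑[ x < k ] (∑[ y < k ] f x y + ∑[ y < k ] f y x)  ≡⟨ sum-cong-≗ (λ x → ∑-distrib-+ (f x) (λ y → f y x)) ⟨
    ∑∑ (λ x y → f x y + f y x)                        ∎

∑ˢ : ∀ m → (Subset m → ℕ) → ℕ
∑ˢ zero    f = f []
∑ˢ (suc m) f = ∑ˢ m (f ∘ (inside ∷_)) + ∑ˢ m (f ∘ (outside ∷_))

∑ˢ-mono-≤ : ∀ m {f g : Subset m → ℕ} → (∀ X → f X ≤ g X) → ∑ˢ m f ≤ ∑ˢ m g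
∑ˢ-mono-≤ zero    f≤g = f≤g []
∑ˢ-mono-≤ (suc m) f≤g = +-mono-≤ (∑ˢ-mono-≤ m (f≤g ∘ (inside ∷_))) (∑ˢ-mono-≤ m (f≤g ∘ (outside ∷_)))

∑ˢ-cong : ∀ m {f g : Subset m → ℕ} → (∀ X → f X ≡ g X) → ∑ˢ m f ≡ ∑ˢ m g
∑ˢ-cong zero    f≡g = f≡g []
∑ˢ-cong (suc m) f≡g = cong₂ _+_ (∑ˢ-cong m (f≡g ∘ (inside ∷_))) (∑ˢ-cong m (f≡g ∘ (outside ∷_)))

∑ˢ-const-0 : ∀ m → ∑ˢ m (λ _ → 0) ≡ 0
∑ˢ-const-0 zero    = refl
∑ˢ-const-0 (suc m) = cong₂ _+_ (∑ˢ-const-0 m) (∑ˢ-const-0 m)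

∑ˢ-distrib-+ : ∀ m (f g : Subset m → ℕ) → ∑ˢ m (λ X → f X + g X) ≡ ∑ˢ m f + ∑ˢ m g
∑ˢ-distrib-+ zero    f g = refl
∑ˢ-distrib-+ (suc m) f g = begin
  ∑ˢ m (λ X → f (inside ∷ X) + g (inside ∷ X)) + ∑ˢ m (λ X → f (outside ∷ X) + g (outside ∷ X))
    ≡⟨ cong₂ _+_ (∑ˢ-distrib-+ m _ _) (∑ˢ-distrib-+ m _ _) ⟩
  (fᵢ + gᵢ) + (fₒ + gₒ)
    ≡⟨ +-interchange fᵢ gᵢ fₒ gₒ ⟩
  (fᵢ + fₒ) + (gᵢ + gₒ) ∎
  where
  open ≡-Reasoning
  fᵢ = ∑ˢ m (f ∘ (inside ∷_))
  fₒ = ∑ˢ m (f ∘ (outside ∷_))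
  gᵢ = ∑ˢ m (g ∘ (inside ∷_))
  gₒ = ∑ˢ m (g ∘ (outside ∷_))

∑ˢ-*-distribˡ : ∀ m c (f : Subset m → ℕ) → ∑ˢ m (λ X → c * f X) ≡ c * ∑ˢ m f
∑ˢ-*-distribˡ zero    c f = refl
∑ˢ-*-distribˡ (suc m) c f =
  trans (cong₂ _+_ (∑ˢ-*-distribˡ m c _) (∑ˢ-*-distribˡ m c _)) (sym (*-distribˡ-+ c _ _))

∑ˢ-∑-comm : ∀ m k (F : Fin k → Subset m → ℕ) → ∑ˢ m (λ X → ∑[ x < k ] F x X) ≡ ∑[ x < k ] ∑ˢ m (F x)
∑ˢ-∑-comm m zero    F = ∑ˢ-const-0 m
∑ˢ-∑-comm m (suc k) F =
  trans (∑ˢ-distrib-+ m (F zero) _) (cong (∑ˢ m (F zero) +_) (∑ˢ-∑-comm m k (F ∘ suc)))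

≤-∑ˢ : ∀ m (f : Subset m → ℕ) X → f X ≤ ∑ˢ m f
≤-∑ˢ zero    f []            = ≤-refl
≤-∑ˢ (suc m) f (inside ∷ X)  = ≤-trans (≤-∑ˢ m _ X) (m≤m+n _ _)
≤-∑ˢ (suc m) f (outside ∷ X) = ≤-trans (≤-∑ˢ m _ X) (m≤n+m _ _)

toggle : ∀ {m} → Fin m → Subset m → Subset m
toggle v X = updateAt X v not

∑ˢ-toggle : ∀ m v (f : Subset m → ℕ) → ∑ˢ m (f ∘ toggle v) ≡ ∑ˢ m f
∑ˢ-toggle (suc m) zero    f = +-comm (∑ˢ m (f ∘ (outside ∷_))) _
∑ˢ-toggle (suc m) (suc v) f =
  cong₂ _+_ (∑ˢ-toggle m v (f ∘ (inside ∷_))) (∑ˢ-toggle m v (f ∘ (outside ∷_)))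

∑ˢ-≤-toggle : ∀ m v {f g : Subset m → ℕ} → (∀ X → f X ≤ g (toggle v X)) → ∑ˢ m f ≤ ∑ˢ m g
∑ˢ-≤-toggle m v {f} {g} f≤g∘toggle =
  ≤-trans (∑ˢ-mono-≤ m f≤g∘toggle) (≤-reflexive (∑ˢ-toggle m v g))

module _ {m} {v w : Fin m} {X : Subset m} where

  ∈-toggle⁺ : w ≢ v → w ∈ X → w ∈ toggle v X
  ∈-toggle⁺ w≢v w∈X = lookup⇒[]= w _ (trans (lookup∘updateAt′ w v w≢v X) ([]=⇒lookup w∈X))

  ∈-toggle⁻ : w ≢ v → w ∈ toggle v X → w ∈ X
  ∈-toggle⁻ w≢v w∈X′ = lookup⇒[]= w X (trans (sym (lookup∘updateAt′ w v w≢v X)) ([]=⇒lookup w∈X′))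

module _ {m} {v : Fin m} {X : Subset m} where

  toggle-adds : v ∉ X → v ∈ toggle v X
  toggle-adds v∉X = lookup⇒[]= v _ (trans (lookup∘updateAt v X) (cong not lookup≡false))
    where
    lookup≡false : lookup X v ≡ false
    lookup≡false with lookup X v in eq
    ... | true  = contradiction (lookup⇒[]= v X eq) v∉X
    ... | false = refl

  toggle-removes : v ∈ X → v ∉ toggle v X
  toggle-removes v∈X v∈X′ with () ← trans (sym ([]=⇒lookup v∈X′)) (trans (lookup∘updateAt v X) (cong not ([]=⇒lookup v∈X)))

subsets : ∀ m → List (Subset m)
subsets zero    = [] ∷ []
subsets (suc m) = map (inside ∷_) (subsets m) ++ map (outside ∷_) (subsets m)

subsets-unique : ∀ m → Unique (subsets m)
subsets-unique zero    = All.[] ∷ []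
subsets-unique (suc m) =
  Unique.++⁺ (Unique.map⁺ ∷-injectiveʳ (subsets-unique m)) (Unique.map⁺ ∷-injectiveʳ (subsets-unique m)) disjoint
  where
  disjoint : ∀ {X} → ¬ (X ∈ₗ map (inside ∷_) (subsets m) × X ∈ₗ map (outside ∷_) (subsets m))
  disjoint (X∈ᵢ , X∈ₒ) with ∈-map⁻ (inside ∷_) X∈ᵢ | ∈-map⁻ (outside ∷_) X∈ₒ
  ... | _ , _ , refl | _ , _ , ()

length-filter-map : ∀ {a b p} {A : Set a} {B : Set b} {P : Pred B p} (P? : Decidable P) (f : A → B) xs →
                    length (filter P? (map f xs)) ≡ length (filter (P? ∘ f) xs)
length-filter-map P? f []       = refl
length-filter-map P? f (x ∷ xs) with does (P? (f x))
... | true  = cong suc (length-filter-map P? f xs)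
... | false = length-filter-map P? f xs

length-filter-subsets : ∀ m {p} {P : Pred (Subset m) p} (P? : Decidable P) →
                        length (filter P? (subsets m)) ≡ ∑ˢ m (𝟙 ∘ P?)
length-filter-subsets zero    P? with P? []
... | yes _ = refl
... | no _  = refl
length-filter-subsets (suc m) P? = begin
  length (filter P? (map (inside ∷_) ss ++ map (outside ∷_) ss))
    ≡⟨ cong length (filter-++ P? (map (inside ∷_) ss) _) ⟩
  length (filter P? (map (inside ∷_) ss) ++ filter P? (map (outside ∷_) ss))
    ≡⟨ length-++ (filter P? (map (inside ∷_) ss)) ⟩
  length (filter P? (map (inside ∷_) ss)) + length (filter P? (map (outside ∷_) ss))
    ≡⟨ cong₂ _+_ (length-filter-map P? (inside ∷_) ss) (length-filter-map P? (outside ∷_) ss) ⟩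
  length (filter (P? ∘ (inside ∷_)) ss) + length (filter (P? ∘ (outside ∷_)) ss)
    ≡⟨ cong₂ _+_ (length-filter-subsets m (P? ∘ (inside ∷_))) (length-filter-subsets m (P? ∘ (outside ∷_))) ⟩
  ∑ˢ (suc m) (𝟙 ∘ P?) ∎
  where
  open ≡-Reasoning
  ss = subsets m

x∉p-x : ∀ {n} {x : Fin n} {p : Subset n} → x ∉ p - x
x∉p-x {x = zero}  {p = s ∷ p} ()
x∉p-x {x = suc x} {p = s ∷ p} (there x∈p-x) = x∉p-x x∈p-x

x∈p-y⇒x≢y : ∀ {n} {x y : Fin n} {p : Subset n} → x ∈ p - y → x ≢ y
x∈p-y⇒x≢y x∈p-x refl = x∉p-x x∈p-x

x∈p-y⇒x∈p : ∀ {n} {x y : Fin n} {p : Subset n} → x ∈ p - y → x ∈ p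
x∈p-y⇒x∈p {y = y} {p} = p─q⊆p p ⁅ y ⁆

x∈p⇒∣p-x∣+1≡∣p∣ : ∀ {n} {x : Fin n} {p : Subset n} → x ∈ p → suc ∣ p - x ∣ ≡ ∣ p ∣
x∈p⇒∣p-x∣+1≡∣p∣ {x = zero}  {p = inside ∷ p}  here          = cong (suc ∘ ∣_∣) (p─⊥≡p p)
x∈p⇒∣p-x∣+1≡∣p∣ {x = suc x} {p = inside ∷ p}  (there x∈p) = cong suc (x∈p⇒∣p-x∣+1≡∣p∣ x∈p)
x∈p⇒∣p-x∣+1≡∣p∣ {x = suc x} {p = outside ∷ p} (there x∈p) = x∈p⇒∣p-x∣+1≡∣p∣ x∈p

removal-induction : ∀ {n ℓ} (P : Subset n → Set ℓ) →
                    (∀ S → (∀ {i} → i ∈ S → P (S - i)) → P S) → ∀ S → P S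
removal-induction P step = WF.All.wfRec (On.wellFounded ∣_∣ <-wellFounded) _ P
  (λ S smaller → step S (λ i∈S → smaller (x∈p⇒∣p-x∣<∣p∣ i∈S)))

halve-after-averaging : ∀ t P c′ c e → 1 ≤ t → t ≤ P → 4 * e ≤ t * P →
                        P * (t * c′) ≤ t * c + 2 * c′ * e → t * c′ ≤ 2 * c
halve-after-averaging t P c′ c e 1≤t t≤P 4e≤tP averaged = *-cancelˡ-≤ t {{>-nonZero 1≤t}} (begin
  t * (t * c′)  ≡⟨ *-assoc t t c′ ⟨
  (t * t) * c′  ≤⟨ *-monoˡ-≤ c′ (*-monoʳ-≤ t t≤P) ⟩
  (t * P) * c′  ≤⟨ tPc′≤2tc ⟩
  2 * (t * c)   ≡⟨ *-left-comm 2 t c ⟩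
  t * (2 * c)   ∎)
  where
  open ≤-Reasoning
  double : ∀ t P c′ → (t * P) * c′ + (t * P) * c′ ≡ 2 * (P * (t * c′))
  double = solve-∀
  expand : ∀ t c c′ e → 2 * (t * c + 2 * c′ * e) ≡ 2 * (t * c) + (4 * e) * c′
  expand = solve-∀
  tPc′≤2tc : (t * P) * c′ ≤ 2 * (t * c)
  tPc′≤2tc = +-cancelʳ-≤ ((t * P) * c′) _ _ (begin
    (t * P) * c′ + (t * P) * c′  ≡⟨ double t P c′ ⟩
    2 * (P * (t * c′))           ≤⟨ *-monoʳ-≤ 2 averaged ⟩
    2 * (t * c + 2 * c′ * e)     ≡⟨ expand t c c′ e ⟩
    2 * (t * c) + (4 * e) * c′   ≤⟨ +-monoʳ-≤ (2 * (t * c)) (*-monoˡ-≤ c′ 4e≤tP) ⟩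
    2 * (t * c) + (t * P) * c′   ∎)

module _ {m n} (G : Graph m) (part : Fin m → Fin n) where

  record IsIndependentTransversal (S : Subset n) (X : Subset m) : Set where
    field
      within      : ∀ {w} → w ∈ X → part w ∈ S
      meets       : ∀ {j} → j ∈ S → ∃[ w ] w ∈ X × part w ≡ j
      atMostOne   : ∀ {u w} → u ∈ X → w ∈ X → part u ≡ part w → u ≡ w
      independent : IsIndependent G X

  IT? : ∀ S X → Dec (IsIndependentTransversal S X)
  IT? S X = map′
    (λ (w , me , a , i) → record { within = w _ ; meets = me _ ; atMostOne = a _ _ ; independent = i })
    (λ it → let open IsIndependentTransversal it in
            (λ _ → within) , (λ _ → meets) , (λ _ _ → atMostOne) , independent)
    (  all? (λ w → w ∈? X →-dec part w ∈? S)
    ×-dec all? (λ j → j ∈? S →-dec any? (λ w → w ∈? X ×-dec part w ≟ j))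
    ×-dec all? (λ u → all? (λ w → u ∈? X →-dec w ∈? X →-dec part u ≟ part w →-dec u ≟ w))
    ×-dec all? (λ u → all? (λ w → u ∈? X →-dec w ∈? X →-dec ¬? (adj G u w ≟ᵇ true))))

  #IT : Subset n → ℕ
  #IT S = ∑ˢ m (λ X → 𝟙 (IT? S X))

  #IT-through : Subset n → Fin m → ℕ
  #IT-through S u = ∑ˢ m (λ X → 𝟙 (IT? S X ×-dec u ∈? X))

  AvoidsNeighboursOf : Fin m → Subset m → Set
  AvoidsNeighboursOf v X = ∀ u → u ∈ X → ¬ adj G u v ≡ true

  avoidsNeighboursOf? : ∀ v X → Dec (AvoidsNeighboursOf v X)
  avoidsNeighboursOf? v X = all? (λ u → u ∈? X →-dec ¬? (adj G u v ≟ᵇ true))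

  #IT-avoiding : Subset n → Fin m → ℕ
  #IT-avoiding S v = ∑ˢ m (λ X → 𝟙 (IT? S X ×-dec avoidsNeighboursOf? v X))

  OutNeighbour : Fin n → Fin m → Fin m → Set
  OutNeighbour i v u = adj G u v ≡ true × part u ≢ i

  outNeighbour? : ∀ i v u → Dec (OutNeighbour i v u)
  outNeighbour? i v u = (adj G u v ≟ᵇ true) ×-dec ¬? (part u ≟ i)

  outDegree : Fin n → Fin m → ℕ
  outDegree i v = ∑[ u < m ] 𝟙 (outNeighbour? i v u)

  module _ {S : Subset n} {X : Subset m} (it : IsIndependentTransversal S X) where
    open IsIndependentTransversal it

    blocking-out-neighbour : ∀ {i v} → i ∉ S → ¬ AvoidsNeighboursOf v X →
                             ∃[ u ] u ∈ X × OutNeighbour i v u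
    blocking-out-neighbour {i} {v} i∉S blocked = u , u∈X , u~v , λ pu≡i → i∉S (subst (_∈ S) pu≡i (within u∈X))
      where
      witness : ∃[ u ] ¬ (u ∈ X → ¬ adj G u v ≡ true)
      witness = ¬∀⟶∃¬ m _ (λ u → u ∈? X →-dec ¬? (adj G u v ≟ᵇ true)) blocked
      u : Fin m
      u = proj₁ witness
      u∈X : u ∈ X
      u∈X = decidable-stable (u ∈? X) (λ u∉X → proj₂ witness (λ u∈X → contradiction u∈X u∉X))
      u~v : adj G u v ≡ true
      u~v = decidable-stable (adj G u v ≟ᵇ true) (λ u≁v → proj₂ witness (λ _ → u≁v))

    remove-vertex : ∀ {u} → u ∈ X → IsIndependentTransversal (S - part u) (toggle u X)
    remove-vertex {u} u∈X = record
      { within      = λ w∈X′ → let w≢u , w∈X = kept w∈X′ in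
                      x∈p∧x≢y⇒x∈p-y (within w∈X) (w≢u ∘ atMostOne w∈X u∈X)
      ; meets       = λ j∈S-pu → let w , w∈X , pw≡j = meets (x∈p-y⇒x∈p j∈S-pu) in
                      w , ∈-toggle⁺ (λ w≡u → x∈p-y⇒x≢y j∈S-pu (trans (sym pw≡j) (cong part w≡u))) w∈X , pw≡j
      ; atMostOne   = λ u∈X′ w∈X′ → atMostOne (proj₂ (kept u∈X′)) (proj₂ (kept w∈X′))
      ; independent = λ a b a∈X′ b∈X′ → independent a b (proj₂ (kept a∈X′)) (proj₂ (kept b∈X′))
      }
      where
      kept : ∀ {w} → w ∈ toggle u X → w ≢ u × w ∈ X
      kept {w} w∈X′ with w ≟ u
      ... | yes refl = contradiction w∈X′ (toggle-removes u∈X)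
      ... | no w≢u   = w≢u , ∈-toggle⁻ w≢u w∈X′

  module _ {S : Subset n} {i : Fin n} {Y : Subset m}
           (it : IsIndependentTransversal (S - i) Y) where
    open IsIndependentTransversal it

    add-vertex : ∀ {v} → part v ≡ i → i ∈ S → AvoidsNeighboursOf v Y →
                 IsIndependentTransversal S (toggle v Y) × v ∈ toggle v Y
    add-vertex {v} pv≡i i∈S v-avoids = record
      { within      = λ w∈Y′ → [ (λ { refl → subst (_∈ S) (sym pv≡i) i∈S }) , x∈p-y⇒x∈p ∘ within ]′ (added w∈Y′)
      ; meets       = meets′
      ; atMostOne   = atMostOne′
      ; independent = independent′
      } , toggle-adds v∉Y
      where
      outside-Vᵢ : ∀ {w} → w ∈ Y → part w ≢ i
      outside-Vᵢ = x∈p-y⇒x≢y ∘ within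
      v∉Y : v ∉ Y
      v∉Y v∈Y = outside-Vᵢ v∈Y pv≡i
      ∈Y⇒≢v : ∀ {w} → w ∈ Y → w ≢ v
      ∈Y⇒≢v w∈Y refl = v∉Y w∈Y
      added : ∀ {w} → w ∈ toggle v Y → w ≡ v ⊎ w ∈ Y
      added {w} w∈Y′ with w ≟ v
      ... | yes w≡v = inj₁ w≡v
      ... | no w≢v  = inj₂ (∈-toggle⁻ w≢v w∈Y′)
      meets′ : ∀ {j} → j ∈ S → ∃[ w ] w ∈ toggle v Y × part w ≡ j
      meets′ {j} j∈S with j ≟ i
      ... | yes refl = v , toggle-adds v∉Y , pv≡i
      ... | no j≢i   = let w , w∈Y , pw≡j = meets (x∈p∧x≢y⇒x∈p-y j∈S j≢i) in
                       w , ∈-toggle⁺ (∈Y⇒≢v w∈Y) w∈Y , pw≡j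
      atMostOne′ : ∀ {a b} → a ∈ toggle v Y → b ∈ toggle v Y → part a ≡ part b → a ≡ b
      atMostOne′ a∈Y′ b∈Y′ pa≡pb with added a∈Y′ | added b∈Y′
      ... | inj₁ refl | inj₁ refl = refl
      ... | inj₁ refl | inj₂ b∈Y  = contradiction (trans (sym pa≡pb) pv≡i) (outside-Vᵢ b∈Y)
      ... | inj₂ a∈Y  | inj₁ refl = contradiction (trans pa≡pb pv≡i) (outside-Vᵢ a∈Y)
      ... | inj₂ a∈Y  | inj₂ b∈Y  = atMostOne a∈Y b∈Y pa≡pb
      independent′ : IsIndependent G (toggle v Y)
      independent′ a b a∈Y′ b∈Y′ with added a∈Y′ | added b∈Y′
      ... | inj₁ refl | inj₁ refl = λ a~a → contradiction (trans (sym a~a) (irrefl G a)) λ ()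
      ... | inj₁ refl | inj₂ b∈Y  = v-avoids b b∈Y ∘ trans (Graph.sym G b a)
      ... | inj₂ a∈Y  | inj₁ refl = v-avoids a a∈Y
      ... | inj₂ a∈Y  | inj₂ b∈Y  = independent a b a∈Y b∈Y

  #IT-through-outside : ∀ {S u} → part u ∉ S → #IT-through S u ≡ 0
  #IT-through-outside {S} {u} pu∉S = trans
    (∑ˢ-cong m (λ X → 𝟙-no (IT? S X ×-dec u ∈? X) (λ (it , u∈X) → pu∉S (IsIndependentTransversal.within it u∈X))))
    (∑ˢ-const-0 m)

  #IT-through≤#IT-remove : ∀ S u → #IT-through S u ≤ #IT (S - part u)
  #IT-through≤#IT-remove S u = ∑ˢ-≤-toggle m u (λ X →
    𝟙-mono (IT? S X ×-dec u ∈? X) (IT? (S - part u) (toggle u X)) (λ (it , u∈X) → remove-vertex it u∈X))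

  #IT-avoiding≤#IT-through : ∀ {S i v} → part v ≡ i → i ∈ S → #IT-avoiding (S - i) v ≤ #IT-through S v
  #IT-avoiding≤#IT-through {S} {i} {v} pv≡i i∈S = ∑ˢ-≤-toggle m v (λ Y →
    𝟙-mono (IT? (S - i) Y ×-dec avoidsNeighboursOf? v Y) (IT? S (toggle v Y) ×-dec v ∈? toggle v Y)
           (λ (it , avoids) → add-vertex it pv≡i i∈S avoids))

  #IT≤#IT-avoiding+blocked : ∀ {S i} v → i ∉ S →
    #IT S ≤ #IT-avoiding S v + ∑[ u < m ] (𝟙 (outNeighbour? i v u) * #IT-through S u)
  #IT≤#IT-avoiding+blocked {S} {i} v i∉S = begin
    ∑ˢ m (λ Y → 𝟙 (IT? S Y))
      ≤⟨ ∑ˢ-mono-≤ m (λ Y → split Y (IT? S Y) (avoidsNeighboursOf? v Y)) ⟩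
    ∑ˢ m (λ Y → 𝟙 (IT? S Y ×-dec avoidsNeighboursOf? v Y) + ∑[ u < m ] blocker u Y)
      ≡⟨ ∑ˢ-distrib-+ m _ _ ⟩
    #IT-avoiding S v + ∑ˢ m (λ Y → ∑[ u < m ] blocker u Y)
      ≡⟨ cong (#IT-avoiding S v +_) (∑ˢ-∑-comm m m blocker) ⟩
    #IT-avoiding S v + ∑[ u < m ] ∑ˢ m (blocker u)
      ≡⟨ cong (#IT-avoiding S v +_) (sum-cong-≗ (λ u → ∑ˢ-*-distribˡ m (𝟙 (outNeighbour? i v u)) (λ Y → 𝟙 (IT? S Y ×-dec u ∈? Y)))) ⟩
    #IT-avoiding S v + ∑[ u < m ] (𝟙 (outNeighbour? i v u) * #IT-through S u) ∎
    where
    open ≤-Reasoning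
    blocker : Fin m → Subset m → ℕ
    blocker u Y = 𝟙 (outNeighbour? i v u) * 𝟙 (IT? S Y ×-dec u ∈? Y)
    -- The decisions are abstracted by hand: IT? S Y unfolds in the goal, so 'with' cannot catch it.
    split : ∀ Y (it? : Dec (IsIndependentTransversal S Y)) (avoids? : Dec (AvoidsNeighboursOf v Y)) →
      𝟙 it? ≤ 𝟙 (it? ×-dec avoids?) + ∑[ u < m ] (𝟙 (outNeighbour? i v u) * 𝟙 (it? ×-dec u ∈? Y))
    split Y (no _)   _            = z≤n
    split Y (yes _)  (yes _)      = m≤m+n 1 _
    split Y (yes it) (no blocked) = let u , u∈Y , out = blocking-out-neighbour it i∉S blocked in
      ≤-trans (≤-reflexive (sym (cong₂ _*_ (𝟙-yes (outNeighbour? i v u) out) (𝟙-yes (yes it ×-dec u ∈? Y) (it , u∈Y)))))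
              (≤-sum (λ u → 𝟙 (outNeighbour? i v u) * 𝟙 (yes it ×-dec u ∈? Y)) u)

  ∑-#IT-through≤#IT : ∀ S i → ∑[ v < m ] (𝟙 (part v ≟ i) * #IT-through S v) ≤ #IT S
  ∑-#IT-through≤#IT S i = begin
    ∑[ v < m ] (𝟙 (part v ≟ i) * #IT-through S v)
      ≡⟨ sum-cong-≗ (λ v → sym (∑ˢ-*-distribˡ m (𝟙 (part v ≟ i)) (λ X → 𝟙 (IT? S X ×-dec v ∈? X)))) ⟩
    ∑[ v < m ] ∑ˢ m (λ X → 𝟙 (part v ≟ i) * 𝟙 (IT? S X ×-dec v ∈? X))
      ≡⟨ ∑ˢ-∑-comm m m _ ⟨
    ∑ˢ m (λ X → ∑[ v < m ] (𝟙 (part v ≟ i) * 𝟙 (IT? S X ×-dec v ∈? X)))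
      ≤⟨ ∑ˢ-mono-≤ m (λ X → at-most-one X (IT? S X)) ⟩
    #IT S ∎
    where
    open ≤-Reasoning
    at-most-one : ∀ X (it? : Dec (IsIndependentTransversal S X)) →
                   ∑[ v < m ] (𝟙 (part v ≟ i) * 𝟙 (it? ×-dec v ∈? X)) ≤ 𝟙 it?
    at-most-one X (no _)   = ≤-reflexive (sum-zero (λ v → *-zeroʳ (𝟙 (part v ≟ i))))
    at-most-one X (yes it) = ≤-trans (≤-reflexive (sum-cong-≗ (λ v → sym (𝟙-× (part v ≟ i) (yes it ×-dec v ∈? X)))))
                                      (∑-𝟙≤1 (λ v → part v ≟ i ×-dec yes it ×-dec v ∈? X)
                                        (λ (pv≡i , _ , v∈X) (pw≡i , _ , w∈X) → atMostOne v∈X w∈X (trans pv≡i (sym pw≡i))))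
      where open IsIndependentTransversal it

  boundaryIndicator : Fin n → Fin m → Fin m → ℕ
  boundaryIndicator i u v = if ⌊ u <? v ⌋ ∧ adj G u v ∧ (inPart part i u xor inPart part i v) then 1 else 0

  boundaryEdges≡∑∑ : ∀ i → boundaryEdges G part i ≡ ∑[ u < m ] ∑[ v < m ] boundaryIndicator i u v
  boundaryEdges≡∑∑ i = trans (sumFin≡sum m _) (sum-cong-≗ (λ u → countFin≡sum m (λ v →
    ⌊ u <? v ⌋ ∧ adj G u v ∧ (inPart part i u xor inPart part i v))))

  edge-crosses : ∀ {i} x y → part x ≡ i → part y ≢ i → adj G x y ≡ true →
                 1 ≤ boundaryIndicator i x y + boundaryIndicator i y x
  edge-crosses {i} x y px≡i py≢i x~y with <-cmp x y
  ... | tri< x<y _ _  = ≤-trans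
          (1≤if-∧-true (⌊⌋-yes (x <? y) x<y) x~y (cong₂ _xor_ (⌊⌋-yes (part x ≟ i) px≡i) (⌊⌋-no (part y ≟ i) py≢i)))
          (m≤m+n (boundaryIndicator i x y) (boundaryIndicator i y x))
  ... | tri≈ _ refl _ = contradiction px≡i py≢i
  ... | tri> _ _ y<x  = ≤-trans
          (1≤if-∧-true (⌊⌋-yes (y <? x) y<x) (trans (Graph.sym G y x) x~y)
                   (cong₂ _xor_ (⌊⌋-no (part y ≟ i) py≢i) (⌊⌋-yes (part x ≟ i) px≡i)))
          (m≤n+m (boundaryIndicator i y x) (boundaryIndicator i x y))

  ∑-outDegree≤boundaryEdges : ∀ i → ∑[ v < m ] (𝟙 (part v ≟ i) * outDegree i v) ≤ boundaryEdges G part i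
  ∑-outDegree≤boundaryEdges i = begin
    ∑[ v < m ] (𝟙 (part v ≟ i) * outDegree i v)
      ≡⟨ sum-cong-≗ (λ v → trans (*-distribˡ-sum (𝟙 (part v ≟ i)) (𝟙 ∘ outNeighbour? i v))
                                  (sum-cong-≗ (λ u → sym (𝟙-× (part v ≟ i) (outNeighbour? i v u))))) ⟩
    ∑[ v < m ] ∑[ u < m ] 𝟙 (part v ≟ i ×-dec outNeighbour? i v u)
      ≤⟨ ∑∑-≤-symmetrised _ (boundaryIndicator i) (λ x y → crossing x y (part x ≟ i ×-dec outNeighbour? i x y)
                                                                    (part y ≟ i ×-dec outNeighbour? i y x)) ⟩
    ∑[ u < m ] ∑[ v < m ] boundaryIndicator i u v
      ≡⟨ boundaryEdges≡∑∑ i ⟨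
    boundaryEdges G part i ∎
    where
    open ≤-Reasoning
    crossing : ∀ x y (d : Dec (part x ≡ i × OutNeighbour i x y)) (e : Dec (part y ≡ i × OutNeighbour i y x)) →
               𝟙 d + 𝟙 e ≤ boundaryIndicator i x y + boundaryIndicator i y x
    crossing x y (yes (_ , _ , py≢i))       (yes (py≡i , _))        = contradiction py≡i py≢i
    crossing x y (yes (px≡i , y~x , py≢i))  (no _)                  =
      edge-crosses x y px≡i py≢i (trans (Graph.sym G x y) y~x)
    crossing x y (no _)                     (yes (py≡i , x~y , px≢i)) =
      ≤-trans (edge-crosses y x py≡i px≢i (trans (Graph.sym G y x) x~y)) (≤-reflexive (+-comm (boundaryIndicator i y x) _))
    crossing x y (no _)                     (no _)                  = z≤n

  #IT-positive : ∀ {S X} → IsIndependentTransversal S X → 1 ≤ #IT S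
  #IT-positive {S} {X} it = ≤-trans (≤-reflexive (sym (𝟙-yes (IT? S X) it))) (≤-∑ˢ m _ X)

  emptyVertexSet-transversal : ∀ {S} → Empty S → IsIndependentTransversal S ⊥
  emptyVertexSet-transversal empty = record
    { within      = λ w∈⊥ → contradiction w∈⊥ ∉⊥
    ; meets       = λ j∈S → contradiction (_ , j∈S) empty
    ; atMostOne   = λ u∈⊥ → contradiction u∈⊥ ∉⊥
    ; independent = λ u _ u∈⊥ → contradiction u∈⊥ ∉⊥
    }

  ⊤-transversal⇒isTransversal : ∀ {X} → IsIndependentTransversal ⊤ X → IsTransversal part X
  ⊤-transversal⇒isTransversal {X} it i = begin
    countFin m (λ v → ⌊ v ∈? X ⌋ ∧ inPart part i v)
      ≡⟨ countFin≡sum m _ ⟩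
    ∑[ v < m ] (if ⌊ v ∈? X ⌋ ∧ ⌊ part v ≟ i ⌋ then 1 else 0)
      ≡⟨ sum-cong-≗ (λ v → cong (if_then 1 else 0) (⌊⌋-× (v ∈? X) (part v ≟ i))) ⟨
    ∑[ v < m ] 𝟙 (v ∈? X ×-dec part v ≟ i)
      ≡⟨ ∑-𝟙≡1 (λ v → v ∈? X ×-dec part v ≟ i) (meets ∈⊤)
               (λ (u∈X , pu≡i) (w∈X , pw≡i) → atMostOne u∈X w∈X (trans pu≡i (sym pw≡i))) ⟩
    1 ∎
    where
    open ≡-Reasoning
    open IsIndependentTransversal it

  partSize≡∑ : ∀ i → partSize part i ≡ ∑[ v < m ] 𝟙 (part v ≟ i)
  partSize≡∑ i = countFin≡sum m (inPart part i)

  module _ (t : ℕ) where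

    RemovalBound : Subset n → Set
    RemovalBound S = ∀ {j} → j ∈ S → t * #IT (S - j) ≤ 2 * #IT S

    through-bound : ∀ {S} u → RemovalBound S → t * #IT-through S u ≤ 2 * #IT S
    through-bound {S} u removal with part u ∈? S
    ... | yes pu∈S = ≤-trans (*-monoʳ-≤ t (#IT-through≤#IT-remove S u)) (removal pu∈S)
    ... | no pu∉S  = ≤-trans (≤-reflexive (trans (cong (t *_) (#IT-through-outside pu∉S)) (*-zeroʳ t))) z≤n

    vertex-bound : ∀ {S i v} → i ∈ S → part v ≡ i → RemovalBound (S - i) →
                   t * #IT (S - i) ≤ t * #IT-through S v + 2 * #IT (S - i) * outDegree i v
    vertex-bound {S} {i} {v} i∈S pv≡i removal = begin
      t * #IT (S - i)
        ≤⟨ *-monoʳ-≤ t (#IT≤#IT-avoiding+blocked v x∉p-x) ⟩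
      t * (#IT-avoiding (S - i) v + ∑[ u < m ] (out u * #IT-through (S - i) u))
        ≡⟨ *-distribˡ-+ t _ _ ⟩
      t * #IT-avoiding (S - i) v + t * ∑[ u < m ] (out u * #IT-through (S - i) u)
        ≡⟨ cong (t * #IT-avoiding (S - i) v +_) (trans (*-distribˡ-sum t (λ u → out u * #IT-through (S - i) u))
                 (sum-cong-≗ (λ u → *-left-comm t (out u) (#IT-through (S - i) u)))) ⟩
      t * #IT-avoiding (S - i) v + ∑[ u < m ] (out u * (t * #IT-through (S - i) u))
        ≤⟨ +-mono-≤ (*-monoʳ-≤ t (#IT-avoiding≤#IT-through pv≡i i∈S))
                    (sum-mono-≤ (λ u → *-monoʳ-≤ (out u) (through-bound u removal))) ⟩
      t * #IT-through S v + ∑[ u < m ] (out u * (2 * #IT (S - i)))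
        ≡⟨ cong (t * #IT-through S v +_) (trans (sum-cong-≗ (λ u → *-comm (out u) _))
                                                (sym (*-distribˡ-sum (2 * #IT (S - i)) out))) ⟩
      t * #IT-through S v + 2 * #IT (S - i) * outDegree i v ∎
      where
      open ≤-Reasoning
      out : Fin m → ℕ
      out u = 𝟙 (outNeighbour? i v u)

    weighted-vertex-bound : ∀ {S i} v → i ∈ S → RemovalBound (S - i) →
      𝟙 (part v ≟ i) * (t * #IT (S - i)) ≤
      t * (𝟙 (part v ≟ i) * #IT-through S v) + 2 * #IT (S - i) * (𝟙 (part v ≟ i) * outDegree i v)
    weighted-vertex-bound {S} {i} v i∈S removal with part v ≟ i
    ... | no _     = z≤n
    ... | yes pv≡i = begin
      1 * (t * #IT (S - i))
        ≡⟨ *-identityˡ _ ⟩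
      t * #IT (S - i)
        ≤⟨ vertex-bound i∈S pv≡i removal ⟩
      t * #IT-through S v + 2 * #IT (S - i) * outDegree i v
        ≡⟨ cong₂ (λ a b → t * a + 2 * #IT (S - i) * b) (*-identityˡ _) (*-identityˡ _) ⟨
      t * (1 * #IT-through S v) + 2 * #IT (S - i) * (1 * outDegree i v) ∎
      where open ≤-Reasoning

    module _ (1≤t : 1 ≤ t)
             (large  : ∀ i → t ≤ partSize part i)
             (sparse : ∀ i → 4 * boundaryEdges G part i ≤ t * partSize part i) where

      removal-step : ∀ {S i} → i ∈ S → RemovalBound (S - i) → t * #IT (S - i) ≤ 2 * #IT S
      removal-step {S} {i} i∈S removal =
        halve-after-averaging t Vᵢ (#IT (S - i)) (#IT S) e 1≤t
          (subst (t ≤_) (partSize≡∑ i) (large i))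
          (≤-trans (*-monoʳ-≤ 4 (∑-outDegree≤boundaryEdges i))
                   (subst (λ s → 4 * boundaryEdges G part i ≤ t * s) (partSize≡∑ i) (sparse i)))
          averaged
        where
        open ≤-Reasoning
        inVᵢ : Fin m → ℕ
        inVᵢ v = 𝟙 (part v ≟ i)
        Vᵢ e c′ : ℕ
        Vᵢ = sum inVᵢ
        e  = ∑[ v < m ] (inVᵢ v * outDegree i v)
        c′ = #IT (S - i)
        averaged : Vᵢ * (t * c′) ≤ t * #IT S + 2 * c′ * e
        averaged = begin
          Vᵢ * (t * c′)
            ≡⟨ *-distribʳ-sum (t * c′) inVᵢ ⟩
          ∑[ v < m ] (inVᵢ v * (t * c′))
            ≤⟨ sum-mono-≤ (λ v → weighted-vertex-bound v i∈S removal) ⟩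
          ∑[ v < m ] (t * (inVᵢ v * #IT-through S v) + 2 * c′ * (inVᵢ v * outDegree i v))
            ≡⟨ ∑-distrib-+ (λ v → t * (inVᵢ v * #IT-through S v)) (λ v → 2 * c′ * (inVᵢ v * outDegree i v)) ⟩
          ∑[ v < m ] (t * (inVᵢ v * #IT-through S v)) + ∑[ v < m ] (2 * c′ * (inVᵢ v * outDegree i v))
            ≡⟨ cong₂ _+_ (*-distribˡ-sum t (λ v → inVᵢ v * #IT-through S v))
                         (*-distribˡ-sum (2 * c′) (λ v → inVᵢ v * outDegree i v)) ⟨
          t * ∑[ v < m ] (inVᵢ v * #IT-through S v) + 2 * c′ * e
            ≤⟨ +-monoˡ-≤ (2 * c′ * e) (*-monoʳ-≤ t (∑-#IT-through≤#IT S i)) ⟩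
          t * #IT S + 2 * c′ * e ∎

      removal-bound : ∀ S → RemovalBound S
      removal-bound = removal-induction RemovalBound (λ S removal i∈S → removal-step i∈S (removal i∈S))

      power-bound : ∀ S → t ^ ∣ S ∣ ≤ 2 ^ ∣ S ∣ * #IT S
      power-bound = removal-induction _ step
        where
        step : ∀ S → (∀ {i} → i ∈ S → t ^ ∣ S - i ∣ ≤ 2 ^ ∣ S - i ∣ * #IT (S - i)) → t ^ ∣ S ∣ ≤ 2 ^ ∣ S ∣ * #IT S
        step S bound with nonempty? S
        ... | yes (i , i∈S) = subst (λ k → t ^ k ≤ 2 ^ k * #IT S) (x∈p⇒∣p-x∣+1≡∣p∣ i∈S) (begin
          t * t ^ k                   ≤⟨ *-monoʳ-≤ t (bound i∈S) ⟩
          t * (2 ^ k * #IT (S - i))   ≡⟨ *-left-comm t (2 ^ k) _ ⟩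
          2 ^ k * (t * #IT (S - i))   ≤⟨ *-monoʳ-≤ (2 ^ k) (removal-bound S i∈S) ⟩
          2 ^ k * (2 * #IT S)         ≡⟨ *-left-comm (2 ^ k) 2 _ ⟩
          2 * (2 ^ k * #IT S)         ≡⟨ *-assoc 2 (2 ^ k) _ ⟨
          2 * 2 ^ k * #IT S           ∎)
          where
          open ≤-Reasoning
          k : ℕ
          k = ∣ S - i ∣
        ... | no empty = subst (λ k → t ^ k ≤ 2 ^ k * #IT S) (sym ∣S∣≡0)
                               (≤-trans (#IT-positive (emptyVertexSet-transversal empty)) (≤-reflexive (sym (*-identityˡ _))))
          where
          ∣S∣≡0 : ∣ S ∣ ≡ 0
          ∣S∣≡0 = trans (cong ∣_∣ (Empty-unique empty)) (∣⊥∣≡0 n)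

corollary10 : (t : ℕ) → 1 ≤ t →
    (m n : ℕ) (G : Graph m) (part : Fin m → Fin n) →
    (∀ i → t ≤ partSize part i) →
    (∀ i → 4 * boundaryEdges G part i ≤ t * partSize part i) →
    Σ (List (Subset m)) (λ Xs →
      Unique Xs ×
      All (λ X → IsTransversal part X × IsIndependent G X) Xs ×
      t ^ n ≤ 2 ^ n * length Xs)
corollary10 t 1≤t m n G part large sparse =
    transversals
  , Unique.filter⁺ (IT? G part ⊤) (subsets-unique m)
  , All.map (λ it → ⊤-transversal⇒isTransversal G part it , IsIndependentTransversal.independent it)
            (all-filter (IT? G part ⊤) (subsets m))
  , (begin
      t ^ n                         ≡⟨ cong (t ^_) (∣⊤∣≡n n) ⟨
      t ^ ∣ ⊤ {n} ∣                 ≤⟨ power-bound G part t 1≤t large sparse ⊤ ⟩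
      2 ^ ∣ ⊤ {n} ∣ * #IT G part ⊤  ≡⟨ cong₂ _*_ (cong (2 ^_) (∣⊤∣≡n n)) (sym (length-filter-subsets m (IT? G part ⊤))) ⟩
      2 ^ n * length transversals   ∎)
  where
  open ≤-Reasoning
  transversals : List (Subset m)
  transversals = filter (IT? G part ⊤) (subsets m)
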